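{- Insertion and deletion are inverse operations: for one-stack sortable permutations $\sigma$ and $\tau$, $\tau$ is obtained from $\sigma$ by a single deletion if and only if $\sigma$ is obtained from $\tau$ by a single insertion.
   Context: Permutations are written as words. One-stack sortable permutations are defined recursively: the empty word is one-stack sortable, and a permutation $\sigma$ of $\{1,\dots,n\}$ with $n\ge 1$ is one-stack sortable if $\sigma = I\,n\,J$ for some $0\le p\le n-1$, where $I$ is a one-stack sortable permutation of $\{1,\dots,p\}$ and $J$ is a word on $\{p+1,\dots,n-1\}$ which becomes a one-stack sortable permutation after subtracting $p$ from each letter ($I$ or $J$ may be empty). A factor of $\sigma=\sigma_1\cdots\sigma_n$ is a word $\sigma_k\sigma_{k+1}\cdots\sigma_{k+l}$ of consecutive letters. A factor is compact if its set of letters is an interval of integers. A factor $f$ of $\sigma$ is complete if it is compact and there is no nonempty factor $g$ of $\sigma$ such that the concatenation $fg$ is a factor of $\sigma$ that is compact and whose largest letter equals the largest letter of $f$. For a word $w=w_1\cdots w_k$ and an integer $a$, $\overline{w}^{a}$ denotes the word $w'_1\cdots w'_k$ with $w'_i=w_i$ if $w_i<a$ and $w'_i=w_i+1$ otherwise. Deletion $(\sigma_k\to\Lambda)$: remove the letter $\sigma_k$ from $\sigma$ and renormalize (decrease by $1$ every letter greater than $\sigma_k$). Insertion: $(\Lambda\to\varnothing)$ transforms the empty permutation into $(1)$. If $\sigma$ is nonempty, let $f$ be a complete factor of $\sigma$ and write $\sigma = u f v$. Then $(\Lambda\to f)$ produces $\overline{u}^{a}\,a\,f\,\overline{v}^{a}$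 with $a=\max f+1$; $(\Lambda \overset{r}{\to} f)$ produces $\overline{u}^{a}\,f\,a\,\overline{v}^{a}$ with $a=\max f+1$; $(\Lambda \overset{l}{\to} f)$ produces $\overline{u}^{a}\,a\,\overline{f}^{a}\,\overline{v}^{a}$ with $a=\min f$. -}

module Defs where

open import Data.Nat using (ℕ; zero; suc; pred; _+_; _≤_; _<ᵇ_; _⊔_; _⊓_)
open import Data.Bool using (if_then_else_)
open import Data.Fin using (Fin)
open import Data.List using (List; []; _∷_; _++_; [_]; map; foldr; length; lookup; removeAt)
open import Data.List.Membership.Propositional using (_∈_)
open import Data.Product using (Σ; ∃; ∃-syntax; _×_; _,_)
open import Data.Sum using (_⊎_)
open import Relation.Nullary using (¬_)
open import Relation.Binary.PropositionalEquality using (_≡_; _≢_)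
open import Function.Bundles using (_⇔_)

Word : Set
Word = List ℕ

-- OSS n σ : σ is a one-stack sortable permutation of {1,…,n}
-- (the recursive definition of the paper: σ = I n J with I an OSS
-- permutation of {1..p} and J = (p + J') with J' an OSS permutation
-- of {1..n-1-p}).
data OSS : ℕ → Word → Set where
  oss-empty : OSS 0 []
  oss-node  : ∀ {p q} {I J : Word} → OSS p I → OSS q J →
              OSS (suc (p + q)) (I ++ [ suc (p + q) ] ++ map (p +_) J)

OneStackSortable : Word → Set
OneStackSortable σ = ∃[ n ] OSS n σ

maxL : Word → ℕ
maxL = foldr _⊔_ 0

minL : Word → ℕ
minL []       = 0
minL (x ∷ xs) = foldr _⊓_ x xs

Compact : Word → Set
Compact w = ∃[ a ] ∃[ b ] (∀ x → (x ∈ w) ⇔ (a ≤ x × x ≤ b))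

-- For a decomposition σ = u f v, the factor f (at that position) is complete:
-- f is nonempty (a factor), compact, and there is no nonempty factor g such that
-- f g is a factor of σ (i.e. g is a nonempty prefix of v), f g is compact and
-- max (f g) = max f.
Complete : Word → Word → Word → Set
Complete u f v =
  f ≢ [] × Compact f ×
  ¬ (∃[ g ] ∃[ w ] (v ≡ g ++ w × g ≢ [] × Compact (f ++ g) × maxL (f ++ g) ≡ maxL f))

bar : ℕ → Word → Word
bar a = map (λ x → if x <ᵇ a then x else suc x)

delete : (σ : Word) → Fin (length σ) → Word
delete σ k = map (λ x → if lookup σ k <ᵇ x then pred x else x) (removeAt σ k)

DeletionStep : Word → Word → Set
DeletionStep σ τ = ∃[ k ] (τ ≡ delete σ k)

data InsertionStep : Word → Word → Set where
  ins-empty : InsertionStep [] [ 1 ]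
  ins-top   : ∀ u f v → Complete u f v →
              InsertionStep (u ++ f ++ v)
                (bar (suc (maxL f)) u ++ [ suc (maxL f) ] ++ f ++ bar (suc (maxL f)) v)
  ins-right : ∀ u f v → Complete u f v →
              InsertionStep (u ++ f ++ v)
                (bar (suc (maxL f)) u ++ f ++ [ suc (maxL f) ] ++ bar (suc (maxL f)) v)
  ins-left  : ∀ u f v → Complete u f v →
              InsertionStep (u ++ f ++ v)
                (bar (minL f) u ++ [ minL f ] ++ bar (minL f) f ++ bar (minL f) v)

module Submission where

-- Deleting a letter a and renormalising (squash a) undoes making room for a (bump a, that is bar a)
-- and inserting it, so every insertion is reversed by deleting the inserted letter.
-- Conversely write σ = I n J′ with J′ = p + J. Deleting n inserts n on top of the complete factor J′
-- (or to the right of I when J is empty). Deleting a letter of I or of J′ is, by induction, an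
-- insertion into I or J, transported into σ: an insertion survives shifting every letter by p and
-- surrounding the word with letters that are all below or all above its own, because appending
-- letters larger than max f keeps a factor f complete. When the inner result is empty, either I = 1
-- and deleting 1 inserts 1 to the left of the remaining word, or J = 1 and the deletion is that of n.

open import Defs
open import Data.List using (List)
open import Data.Nat using (ℕ)
open import Function.Bundles using (_⇔_)

open import Data.Bool.Base using (true; false; if_then_else_)
open import Data.Fin.Base as Fin using ()
open import Data.List.Base using ([]; _∷_; _++_; [_]; map; foldr; lookup; removeAt)
open import Data.List.Properties
  using (map-++; map-∘; map-id; map-cong; map-id-local; map-cong-local; ++-assoc; ++-identityʳ;
         ++-conicalˡ; ++-conicalʳ; ∷-injective; foldr-preservesᵇ; foldr-preservesᵒ; ++-monoid)
open import Data.List.Membership.Propositional using (_∈_)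
open import Data.List.Membership.Propositional.Properties using (∈-map⁺; ∈-map⁻; ∈-++⁺ˡ; ∈-++⁺ʳ)
open import Data.List.Relation.Unary.All as All using (All; []; _∷_)
open import Data.List.Relation.Unary.All.Properties using (++⁺; ++⁻ˡ; ++⁻ʳ; map⁺)
open import Data.List.Relation.Unary.Any as Any using (here; there)
open import Data.Nat.Base using (zero; suc; pred; _+_; _≤_; _<_; _<ᵇ_; _⊔_; _⊓_; z≤n; s≤s)
open import Data.Nat.Properties
open import Data.Product.Base using (∃-syntax; _×_; _,_; proj₁; proj₂)
open import Data.Sum.Base using (_⊎_; inj₁; inj₂; [_,_]′)
open import Function.Base using (_∘_)
open import Function.Bundles using (mk⇔; Equivalence)
open import Relation.Binary.PropositionalEquality
  using (_≡_; _≢_; refl; sym; trans; cong; cong₂; subst; subst₂; module ≡-Reasoning)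
open import Relation.Nullary using (¬_; yes; no; contradiction)
open import Tactic.MonoidSolver using (solve)

-- delete σ k is map (squash (lookup σ k)) (removeAt σ k) and bar a is map (bump a), definitionally.
squash : ℕ → ℕ → ℕ
squash a x = if a <ᵇ x then pred x else x

bump : ℕ → ℕ → ℕ
bump a x = if x <ᵇ a then x else suc x

<ᵇ-true : ∀ {m n} → m < n → (m <ᵇ n) ≡ true
<ᵇ-true (s≤s z≤n)       = refl
<ᵇ-true (s≤s (s≤s m<n)) = <ᵇ-true (s≤s m<n)

<ᵇ-false : ∀ {m n} → n ≤ m → (m <ᵇ n) ≡ false
<ᵇ-false z≤n       = refl
<ᵇ-false (s≤s n≤m) = <ᵇ-false n≤m

+-<ᵇ : ∀ p {m n} → (p + m <ᵇ p + n) ≡ (m <ᵇ n)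
+-<ᵇ zero    = refl
+-<ᵇ (suc p) = +-<ᵇ p

bump-< : ∀ {a x} → x < a → bump a x ≡ x
bump-< {x = x} x<a = cong (if_then x else suc x) (<ᵇ-true x<a)

bump-≥ : ∀ {a x} → a ≤ x → bump a x ≡ suc x
bump-≥ {x = x} a≤x = cong (if_then x else suc x) (<ᵇ-false a≤x)

bump-+ : ∀ p a x → bump (p + a) (p + x) ≡ p + bump a x
bump-+ p a x rewrite +-<ᵇ p {x} {a} with x <ᵇ a
... | true  = refl
... | false = sym (+-suc p x)

squash-≤ : ∀ {a x} → x ≤ a → squash a x ≡ x
squash-≤ {x = x} x≤a = cong (if_then pred x else x) (<ᵇ-false x≤a)

squash-> : ∀ {a x} → a < x → squash a x ≡ pred x
squash-> {x = x} a<x = cong (if_then pred x else x) (<ᵇ-true a<x)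

squash-+ : ∀ p a x → squash (p + a) (p + x) ≡ p + squash a x
squash-+ p a zero    rewrite +-<ᵇ p {a} {zero} = refl
squash-+ p a (suc x) rewrite +-<ᵇ p {a} {suc x} with a <ᵇ suc x
... | true  = cong pred (+-suc p x)
... | false = refl

squash-bump : ∀ a x → squash a (bump a x) ≡ x
squash-bump a x with x <? a
... | yes x<a = trans (cong (squash a) (bump-< x<a)) (squash-≤ (<⇒≤ x<a))
... | no  x≮a = trans (cong (squash a) (bump-≥ (≮⇒≥ x≮a))) (squash-> (s≤s (≮⇒≥ x≮a)))

map-commute : ∀ {f g h : ℕ → ℕ} → (∀ x → f (g x) ≡ g (h x)) →
  ∀ w → map f (map g w) ≡ map g (map h w)
map-commute fg≡gh w = trans (sym (map-∘ w)) (trans (map-cong fg≡gh w) (map-∘ w))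

bar-< : ∀ {a w} → All (_< a) w → bar a w ≡ w
bar-< w<a = map-id-local (All.map bump-< w<a)

bar-≥ : ∀ {a w} → All (a ≤_) w → bar a w ≡ map suc w
bar-≥ a≤w = map-cong-local (All.map bump-≥ a≤w)

bar-+ : ∀ p a w → bar (p + a) (map (p +_) w) ≡ map (p +_) (bar a w)
bar-+ p a = map-commute (bump-+ p a)

map-squash-bar : ∀ a w → map (squash a) (bar a w) ≡ w
map-squash-bar a w = trans (sym (map-∘ w)) (trans (map-cong (squash-bump a) w) (map-id w))

map-squash-≤ : ∀ {a w} → All (_≤ a) w → map (squash a) w ≡ w
map-squash-≤ w≤a = map-id-local (All.map squash-≤ w≤a)

map-squash-> : ∀ {a w} → All (a <_) w → map (squash a) w ≡ map pred w
map-squash-> a<w = map-cong-local (All.map squash-> a<w)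

map-squash-+ : ∀ p a w → map (squash (p + a)) (map (p +_) w) ≡ map (p +_) (map (squash a) w)
map-squash-+ p a = map-commute (squash-+ p a)

map-suc-pred : ∀ {m w} → All (m <_) w → map suc (map pred w) ≡ w
map-suc-pred {w = w} m<w = trans (sym (map-∘ w)) (map-id-local (All.map suc-pred-< m<w))
  where
  suc-pred-< : ∀ {m x} → m < x → suc (pred x) ≡ x
  suc-pred-< (s≤s _) = refl

maxL-upper : ∀ {x w} → x ∈ w → x ≤ maxL w
maxL-upper {w = y ∷ w} (here refl)  = m≤m⊔n y (maxL w)
maxL-upper {w = y ∷ w} (there x∈w) = m≤n⇒m≤o⊔n y (maxL-upper x∈w)

xs≤1+maxL : ∀ w → All (_≤ suc (maxL w)) w
xs≤1+maxL w = All.tabulate (m≤n⇒m≤1+n ∘ maxL-upper)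

maxL-lub : ∀ {b w} → All (_≤ b) w → maxL w ≤ b
maxL-lub = foldr-preservesᵇ ⊔-lub z≤n

maxL-≡ : ∀ {b w} → b ∈ w → All (_≤ b) w → maxL w ≡ b
maxL-≡ b∈w w≤b = ≤-antisym (maxL-lub w≤b) (maxL-upper b∈w)

maxL-+ : ∀ p {w} → w ≢ [] → maxL (map (p +_) w) ≡ p + maxL w
maxL-+ p {[]}            w≢[] = contradiction refl w≢[]
maxL-+ p {x ∷ []}        _    = trans (⊔-identityʳ (p + x)) (cong (p +_) (sym (⊔-identityʳ x)))
maxL-+ p {x ∷ w@(_ ∷ _)} _    =
  trans (cong ((p + x) ⊔_) (maxL-+ p {w} λ ())) (sym (+-distribˡ-⊔ p x (maxL w)))

minL-lower : ∀ {x w} → x ∈ w → minL w ≤ x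
minL-lower {w = y ∷ ys} x∈w =
  foldr-preservesᵒ (λ m n → [ m≤n⇒m⊓o≤n n , m≤n⇒o⊓m≤n m ]′) y ys (≤-witness x∈w)
  where
  ≤-witness : ∀ {x y ys} → x ∈ y ∷ ys → y ≤ x ⊎ Any.Any (_≤ x) ys
  ≤-witness (here refl)   = inj₁ ≤-refl
  ≤-witness (there x∈ys) = inj₂ (Any.map (λ { refl → ≤-refl }) x∈ys)

minL-glb : ∀ {b x xs} → All (b ≤_) (x ∷ xs) → b ≤ minL (x ∷ xs)
minL-glb (b≤x ∷ b≤xs) = foldr-preservesᵇ ⊓-glb b≤x b≤xs

minL-≡ : ∀ {b w} → b ∈ w → All (b ≤_) w → minL w ≡ b
minL-≡ {w = _ ∷ _} b∈w b≤w = ≤-antisym (minL-lower b∈w) (minL-glb b≤w)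

minL-+ : ∀ p {w} → w ≢ [] → minL (map (p +_) w) ≡ p + minL w
minL-+ p {[]}    w≢[] = contradiction refl w≢[]
minL-+ p {x ∷ w} _    = foldr-⊓-+ w
  where
  foldr-⊓-+ : ∀ w → foldr _⊓_ (p + x) (map (p +_) w) ≡ p + foldr _⊓_ x w
  foldr-⊓-+ []      = refl
  foldr-⊓-+ (y ∷ w) = trans (cong ((p + y) ⊓_) (foldr-⊓-+ w)) (sym (+-distribˡ-⊓ p y _))

∈⇒≢[] : ∀ {A : Set} {x : A} {xs} → x ∈ xs → xs ≢ []
∈⇒≢[] (here _)  ()
∈⇒≢[] (there _) ()

map-≢[] : ∀ {A B : Set} {f : A → B} {xs} → xs ≢ [] → map f xs ≢ []
map-≢[] {xs = []}    xs≢[] _ = xs≢[] refl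
map-≢[] {xs = _ ∷ _} _     ()

++-middle-[] : ∀ {A : Set} (u f v : List A) → u ++ f ++ v ≡ [] → f ≡ []
++-middle-[] u f v eq = ++-conicalˡ f v (++-conicalʳ u (f ++ v) eq)

++-split : ∀ {A : Set} (xs ys zs ws : List A) → xs ++ ys ≡ zs ++ ws →
  (∃[ m ] xs ≡ zs ++ m × ws ≡ m ++ ys) ⊎ (∃[ z ] ∃[ m ] zs ≡ xs ++ z ∷ m × ys ≡ z ∷ m ++ ws)
++-split []       ys []       ws eq = inj₁ ([] , refl , sym eq)
++-split []       ys (z ∷ zs) ws eq = inj₂ (z , zs , refl , eq)
++-split (x ∷ xs) ys []       ws eq = inj₁ (x ∷ xs , refl , sym eq)
++-split (x ∷ xs) ys (z ∷ zs) ws eq with refl , eq′ ← ∷-injective eq with ++-split xs ys zs ws eq′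
... | inj₁ (m , xs≡ , ws≡)     = inj₁ (m , cong (x ∷_) xs≡ , ws≡)
... | inj₂ (z , m , zs≡ , ys≡) = inj₂ (z , m , cong (x ∷_) zs≡ , ys≡)

++-∷-split : ∀ {A : Set} (I : List A) {y J α x β} → I ++ y ∷ J ≡ α ++ x ∷ β →
  (∃[ γ ] I ≡ α ++ x ∷ γ × β ≡ γ ++ y ∷ J) ⊎
  (α ≡ I × x ≡ y × β ≡ J) ⊎
  (∃[ δ ] α ≡ I ++ y ∷ δ × J ≡ δ ++ x ∷ β)
++-∷-split []      {α = []}    refl = inj₂ (inj₁ (refl , refl , refl))
++-∷-split []      {α = _ ∷ α} eq with refl , J≡ ← ∷-injective eq = inj₂ (inj₂ (α , refl , J≡))
++-∷-split (_ ∷ I) {α = []}    eq with refl , β≡ ← ∷-injective eq = inj₁ (I , refl , sym β≡)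
++-∷-split (i ∷ I) {α = _ ∷ α} eq with refl , eq′ ← ∷-injective eq with ++-∷-split I eq′
... | inj₁ (γ , I≡ , β≡)         = inj₁ (γ , cong (i ∷_) I≡ , β≡)
... | inj₂ (inj₁ (α≡ , x≡ , β≡)) = inj₂ (inj₁ (cong (i ∷_) α≡ , x≡ , β≡))
... | inj₂ (inj₂ (δ , α≡ , J≡))  = inj₂ (inj₂ (δ , cong (i ∷_) α≡ , J≡))

map-++⁻ : ∀ {A B : Set} (f : A → B) xs ys {zs} → map f xs ≡ ys ++ zs →
  ∃[ ys₀ ] ∃[ zs₀ ] xs ≡ ys₀ ++ zs₀ × ys ≡ map f ys₀ × zs ≡ map f zs₀
map-++⁻ f xs       []       eq = [] , xs , refl , refl , sym eq
map-++⁻ f (x ∷ xs) (_ ∷ ys) eq with refl , eq′ ← ∷-injective eq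
  with ys₀ , zs₀ , refl , refl , refl ← map-++⁻ f xs ys eq′ = x ∷ ys₀ , zs₀ , refl , refl , refl

∈-map-+⁻ : ∀ p {y w} → p + y ∈ map (p +_) w → y ∈ w
∈-map-+⁻ p p+y∈ with z , z∈w , p+y≡p+z ← ∈-map⁻ (p +_) p+y∈ =
  subst (_∈ _) (sym (+-cancelˡ-≡ p _ _ p+y≡p+z)) z∈w

compact-+ : ∀ p {w} → Compact w → Compact (map (p +_) w)
compact-+ p {w} (a , b , w≈[a,b]) = p + a , p + b , λ x → mk⇔ (to x) (from x)
  where
  to : ∀ x → x ∈ map (p +_) w → p + a ≤ x × x ≤ p + b
  to x x∈ with y , y∈w , refl ← ∈-map⁻ (p +_) x∈ =
    let a≤y , y≤b = Equivalence.to (w≈[a,b] y) y∈w in +-monoʳ-≤ p a≤y , +-monoʳ-≤ p y≤b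
  from : ∀ x → p + a ≤ x × x ≤ p + b → x ∈ map (p +_) w
  from x (p+a≤x , x≤p+b) with y , refl ← m≤n⇒∃[o]m+o≡n (≤-trans (m≤m+n p a) p+a≤x) =
    ∈-map⁺ (p +_) (Equivalence.from (w≈[a,b] y) (+-cancelˡ-≤ p a y p+a≤x , +-cancelˡ-≤ p y b x≤p+b))

-- The endpoints of the interval of a nonempty p + w are letters of it, hence of the form p + _.
compact-+⁻ : ∀ p {w} → w ≢ [] → Compact (map (p +_) w) → Compact w
compact-+⁻ p {[]}    w≢[] _ = contradiction refl w≢[]
compact-+⁻ p {y ∷ w} _ (a , b , w′≈[a,b])
  with a≤p+y , p+y≤b ← Equivalence.to (w′≈[a,b] (p + y)) (here refl)
  with a≤b ← ≤-trans a≤p+y p+y≤b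
  with a₀ , _ , refl ← ∈-map⁻ (p +_) (Equivalence.from (w′≈[a,b] a) (≤-refl , a≤b))
  with b₀ , _ , refl ← ∈-map⁻ (p +_) (Equivalence.from (w′≈[a,b] b) (a≤b , ≤-refl))
  = a₀ , b₀ , λ x → mk⇔
      (λ x∈ → let l , u = Equivalence.to (w′≈[a,b] (p + x)) (∈-map⁺ (p +_) x∈)
              in +-cancelˡ-≤ p _ _ l , +-cancelˡ-≤ p _ _ u)
      (λ (l , u) → ∈-map-+⁻ p (Equivalence.from (w′≈[a,b] (p + x)) (+-monoʳ-≤ p l , +-monoʳ-≤ p u)))

CompactExtension : Word → Word → Set
CompactExtension f v = ∃[ g ] ∃[ w ] (v ≡ g ++ w × g ≢ [] × Compact (f ++ g) × maxL (f ++ g) ≡ maxL f)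

-- Complete u f v does not mention u, so these lemmas fix u = []; the results convert to any prefix.
complete-end : ∀ {f} → f ≢ [] → Compact f → Complete [] f []
complete-end f≢[] f-compact =
  f≢[] , f-compact , λ (g , w , []≡g++w , g≢[] , _) → g≢[] (++-conicalˡ g w (sym []≡g++w))

complete-++ : ∀ {f v S} → Complete [] f v → All (maxL f <_) S → Complete [] f (v ++ S)
complete-++ {f = f} {v} {S} (f≢[] , f-compact , f-maximal) f<S = f≢[] , f-compact , maximal
  where
  maximal : ¬ CompactExtension f (v ++ S)
  maximal (g , w , v++S≡g++w , g≢[] , fg-compact , fg-max) with ++-split v S g w v++S≡g++w
  ... | inj₁ (m , v≡g++m , _) = f-maximal (g , m , v≡g++m , g≢[] , fg-compact , fg-max)
  ... | inj₂ (s , m , g≡v++s∷m , S≡s∷m++w) =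
    <⇒≱ (All.lookup f<S s∈S) (subst (s ≤_) fg-max (maxL-upper (∈-++⁺ʳ f s∈g)))
    where
    s∈S : s ∈ S
    s∈S = subst (s ∈_) (sym S≡s∷m++w) (here refl)
    s∈g : s ∈ g
    s∈g = subst (s ∈_) (sym g≡v++s∷m) (∈-++⁺ʳ v (here refl))

complete-+ : ∀ {f v} p → Complete [] f v → Complete [] (map (p +_) f) (map (p +_) v)
complete-+ {f = f} {v} p (f≢[] , f-compact , f-maximal) =
  map-≢[] f≢[] , compact-+ p f-compact , maximal
  where
  maximal : ¬ CompactExtension (map (p +_) f) (map (p +_) v)
  maximal (g′ , w′ , v′≡g′++w′ , g′≢[] , fg′-compact , fg′-max)
    with g , w , v≡g++w , refl , refl ← map-++⁻ (p +_) v g′ v′≡g′++w′ =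
    f-maximal (g , w , v≡g++w , g′≢[] ∘ cong (map (p +_)) , fg-compact , fg-max)
    where
    fg≢[] : f ++ g ≢ []
    fg≢[] = f≢[] ∘ ++-conicalˡ f g
    fg-compact : Compact (f ++ g)
    fg-compact = compact-+⁻ p fg≢[] (subst Compact (sym (map-++ (p +_) f g)) fg′-compact)
    fg-max : maxL (f ++ g) ≡ maxL f
    fg-max = +-cancelˡ-≡ p _ _ (begin
      p + maxL (f ++ g)                   ≡⟨ maxL-+ p fg≢[] ⟨
      maxL (map (p +_) (f ++ g))          ≡⟨ cong maxL (map-++ (p +_) f g) ⟩
      maxL (map (p +_) f ++ map (p +_) g) ≡⟨ fg′-max ⟩
      maxL (map (p +_) f)                 ≡⟨ maxL-+ p f≢[] ⟩
      p + maxL f                          ∎)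
      where open ≡-Reasoning

Letter : ℕ → ℕ → Set
Letter n x = 1 ≤ x × x ≤ n

oss-letters : ∀ {n w} → OSS n w → All (Letter n) w
oss-letters oss-empty = []
oss-letters (oss-node {p} {q} oI oJ) =
  ++⁺ (All.map below (oss-letters oI)) ((s≤s z≤n , ≤-refl) ∷ map⁺ (All.map above (oss-letters oJ)))
  where
  below : ∀ {x} → Letter p x → Letter (suc (p + q)) x
  below (1≤x , x≤p) = 1≤x , m≤n⇒m≤1+n (≤-trans x≤p (m≤m+n p q))
  above : ∀ {y} → Letter q y → Letter (suc (p + q)) (p + y)
  above {y} (1≤y , y≤q) = ≤-trans 1≤y (m≤n+m y p) , m≤n⇒m≤1+n (+-monoʳ-≤ p y≤q)

oss-∈ : ∀ {n w x} → OSS n w → Letter n x → x ∈ w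
oss-∈ oss-empty (s≤s z≤n , ())
oss-∈ {x = x} (oss-node {p} {q} {I} oI oJ) (1≤x , x≤1+p+q) with x ≤? p
... | yes x≤p = ∈-++⁺ˡ (oss-∈ oI (1≤x , x≤p))
... | no  x≰p with y , refl ← m≤n⇒∃[o]m+o≡n (<⇒≤ (≰⇒> x≰p)) with y ≤? q
...   | yes y≤q = ∈-++⁺ʳ I (there (∈-map⁺ (p +_) (oss-∈ oJ (1≤y , y≤q))))
  where
  1≤y : 1 ≤ y
  1≤y = +-cancelˡ-≤ p 1 y (subst (_≤ p + y) (+-comm 1 p) (≰⇒> x≰p))
...   | no  y≰q = ∈-++⁺ʳ I (here (trans (cong (p +_) y≡1+q) (+-suc p q)))
  where
  y≡1+q : y ≡ suc q
  y≡1+q = ≤-antisym (+-cancelˡ-≤ p y (suc q) (subst (p + y ≤_) (sym (+-suc p q)) x≤1+p+q)) (≰⇒> y≰q)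

oss-compact : ∀ {n w} → OSS n w → Compact w
oss-compact {n} o = 1 , n , λ x → mk⇔ (All.lookup (oss-letters o)) (oss-∈ o)

oss-max : ∀ {n w} → OSS n w → maxL w ≡ n
oss-max oss-empty        = refl
oss-max o@(oss-node _ _) = maxL-≡ (oss-∈ o (s≤s z≤n , ≤-refl)) (All.map proj₂ (oss-letters o))

oss-≢[] : ∀ {n w} → OSS (suc n) w → w ≢ []
oss-≢[] o = ∈⇒≢[] (oss-∈ o (s≤s z≤n , ≤-refl))

upper-part-> : ∀ p {q J} → OSS q J → All (p <_) (suc (p + q) ∷ map (p +_) J)
upper-part-> p {q} oJ =
  s≤s (m≤m+n p q) ∷ map⁺ (All.map (λ (1≤y , _) → m<m+n p 1≤y) (oss-letters oJ))

removeAt-split : ∀ (σ : Word) k → ∃[ α ] ∃[ β ] σ ≡ α ++ lookup σ k ∷ β × removeAt σ k ≡ α ++ β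
removeAt-split (y ∷ σ) Fin.zero    = [] , σ , refl , refl
removeAt-split (y ∷ σ) (Fin.suc k) =
  let α , β , σ≡ , removed = removeAt-split σ k in y ∷ α , β , cong (y ∷_) σ≡ , cong (y ∷_) removed

removeAt-middle : ∀ α (x : ℕ) β →
  ∃[ k ] lookup (α ++ x ∷ β) k ≡ x × removeAt (α ++ x ∷ β) k ≡ α ++ β
removeAt-middle []      x β = Fin.zero , refl , refl
removeAt-middle (a ∷ α) x β =
  let k , looked-up , removed = removeAt-middle α x β in Fin.suc k , looked-up , cong (a ∷_) removed

deletion⁻ : ∀ {σ τ} → DeletionStep σ τ →
  ∃[ α ] ∃[ x ] ∃[ β ] σ ≡ α ++ x ∷ β × τ ≡ map (squash x) (α ++ β)
deletion⁻ {σ} (k , refl) =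
  let α , β , σ≡ , removed = removeAt-split σ k
  in α , lookup σ k , β , σ≡ , cong (map (squash (lookup σ k))) removed

deletion⁺ : ∀ {σ τ} α x β → σ ≡ α ++ x ∷ β → τ ≡ map (squash x) (α ++ β) → DeletionStep σ τ
deletion⁺ α x β refl refl =
  let k , looked-up , removed = removeAt-middle α x β
  in k , sym (cong₂ (λ y r → map (squash y) r) looked-up removed)

squash-around : ∀ a u v {M M′} → map (squash a) M ≡ M′ →
  map (squash a) (bar a u ++ M ++ bar a v) ≡ u ++ M′ ++ v
squash-around a u v {M} {M′} M≡M′ = begin
  map (squash a) (bar a u ++ M ++ bar a v)
    ≡⟨ map-++ _ (bar a u) _ ⟩
  map (squash a) (bar a u) ++ map (squash a) (M ++ bar a v)
    ≡⟨ cong₂ _++_ (map-squash-bar a u) (map-++ _ M _) ⟩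
  u ++ map (squash a) M ++ map (squash a) (bar a v)
    ≡⟨ cong (u ++_) (cong₂ _++_ M≡M′ (map-squash-bar a v)) ⟩
  u ++ M′ ++ v ∎
  where open ≡-Reasoning

insertion⇒deletion : ∀ {τ σ} → InsertionStep τ σ → DeletionStep σ τ
insertion⇒deletion ins-empty = deletion⁺ [] 1 [] refl refl
insertion⇒deletion (ins-top u f v _) =
  deletion⁺ (bar a u) a (f ++ bar a v) refl
    (sym (squash-around a u v (map-squash-≤ (xs≤1+maxL f))))
  where a = suc (maxL f)
insertion⇒deletion (ins-right u f v _) =
  deletion⁺ (bar a u ++ f) a (bar a v) (sym (++-assoc (bar a u) f _))
    (sym (trans (cong (map (squash a)) (++-assoc (bar a u) f _))
                (squash-around a u v (map-squash-≤ (xs≤1+maxL f)))))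
  where a = suc (maxL f)
insertion⇒deletion (ins-left u f v _) =
  deletion⁺ (bar a u) a (bar a f ++ bar a v) refl
    (sym (squash-around a u v (map-squash-bar a f)))
  where a = minL f

insertion-into-[] : ∀ {τ σ} → InsertionStep τ σ → τ ≡ [] → σ ≡ [ 1 ]
insertion-into-[] ins-empty                     _    = refl
insertion-into-[] (ins-top   u f v (f≢[] , _)) τ≡[] = contradiction (++-middle-[] u f v τ≡[]) f≢[]
insertion-into-[] (ins-right u f v (f≢[] , _)) τ≡[] = contradiction (++-middle-[] u f v τ≡[]) f≢[]
insertion-into-[] (ins-left  u f v (f≢[] , _)) τ≡[] = contradiction (++-middle-[] u f v τ≡[]) f≢[]

insert-top : ∀ u {f v a} → Complete u f v → a ≡ suc (maxL f) →
  InsertionStep (u ++ f ++ v) (bar a u ++ (a ∷ f) ++ bar a v)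
insert-top u c refl = ins-top u _ _ c

insert-right : ∀ u {f v a} → Complete u f v → a ≡ suc (maxL f) →
  InsertionStep (u ++ f ++ v) (bar a u ++ (f ++ [ a ]) ++ bar a v)
insert-right u {f} {v} {a} c refl =
  subst (InsertionStep _) (cong (bar a u ++_) (sym (++-assoc f [ a ] (bar a v)))) (ins-right u f v c)

insert-left : ∀ u {f v a} → Complete u f v → a ≡ minL f →
  InsertionStep (u ++ f ++ v) (bar a u ++ (a ∷ bar a f) ++ bar a v)
insert-left u c refl = ins-left u _ _ c

map-++-context : ∀ (g : ℕ → ℕ) (X Y u m v Z : Word) →
  X ++ Y ++ map g (u ++ m ++ v) ++ Z ≡ (X ++ Y ++ map g u) ++ map g m ++ map g v ++ Z
map-++-context g X Y u m v Z rewrite map-++ g u (m ++ v) | map-++ g m v = solve (++-monoid ℕ)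

module _ (p : ℕ) {B : ℕ} {L H S : Word}
         (L≤p : All (_≤ p) L) (H≥p+B : All (p + B ≤_) H) (S≥p+B : All (p + B ≤_) S) where

  bar-prefix : ∀ {a} u → Letter B a →
    bar (p + a) (L ++ H ++ map (p +_) u) ≡ L ++ map suc H ++ map (p +_) (bar a u)
  bar-prefix {a} u (1≤a , a≤B) =
    trans (map-++ (bump (p + a)) L _)
      (cong₂ _++_ (bar-< L<p+a) (trans (map-++ (bump (p + a)) H _) (cong₂ _++_ (bar-≥ H≥p+a) (bar-+ p a u))))
    where
    L<p+a : All (_< p + a) L
    L<p+a = All.map (λ x≤p → ≤-<-trans x≤p (m<m+n p 1≤a)) L≤p
    H≥p+a : All (p + a ≤_) H
    H≥p+a = All.map (≤-trans (+-monoʳ-≤ p a≤B)) H≥p+B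

  bar-suffix : ∀ {a} v → a ≤ B → bar (p + a) (map (p +_) v ++ S) ≡ map (p +_) (bar a v) ++ map suc S
  bar-suffix {a} v a≤B =
    trans (map-++ (bump (p + a)) (map (p +_) v) S)
      (cong₂ _++_ (bar-+ p a v) (bar-≥ (All.map (≤-trans (+-monoʳ-≤ p a≤B)) S≥p+B)))

  bar-context : ∀ {a} u v M {M′} → map (p +_) M ≡ M′ → Letter B a →
    bar (p + a) (L ++ H ++ map (p +_) u) ++ M′ ++ bar (p + a) (map (p +_) v ++ S)
      ≡ L ++ map suc H ++ map (p +_) (bar a u ++ M ++ bar a v) ++ map suc S
  bar-context {a} u v M refl a-letter@(_ , a≤B) = begin
    bar (p + a) (L ++ H ++ map (p +_) u) ++ map (p +_) M ++ bar (p + a) (map (p +_) v ++ S)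
      ≡⟨ cong₂ (λ x y → x ++ map (p +_) M ++ y) (bar-prefix u a-letter) (bar-suffix v a≤B) ⟩
    (L ++ map suc H ++ map (p +_) (bar a u)) ++ map (p +_) M ++ map (p +_) (bar a v) ++ map suc S
      ≡⟨ map-++-context (p +_) L (map suc H) (bar a u) M (bar a v) (map suc S) ⟨
    L ++ map suc H ++ map (p +_) (bar a u ++ M ++ bar a v) ++ map suc S ∎
    where open ≡-Reasoning

  complete-lift : ∀ {f v} → Complete [] f v → maxL f < B →
    Complete [] (map (p +_) f) (map (p +_) v ++ S)
  complete-lift {f} c@(f≢[] , _) f<B = complete-++ (complete-+ p c) (All.map (<-≤-trans f′<p+B) S≥p+B)
    where
    f′<p+B : maxL (map (p +_) f) < p + B
    f′<p+B = subst (_< p + B) (sym (maxL-+ p f≢[])) (+-monoʳ-< p f<B)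

  1+maxL-+ : ∀ {f} → f ≢ [] → p + suc (maxL f) ≡ suc (maxL (map (p +_) f))
  1+maxL-+ f≢[] = trans (+-suc p _) (cong suc (sym (maxL-+ p f≢[])))

  lift-insertion : ∀ {τ σ} → InsertionStep τ σ → τ ≢ [] → All (Letter B) σ →
    InsertionStep (L ++ H ++ map (p +_) τ ++ S) (L ++ map suc H ++ map (p +_) σ ++ map suc S)
  lift-insertion ins-empty τ≢[] _ = contradiction refl τ≢[]
  lift-insertion (ins-top u f v c@(f≢[] , _)) _ σ-letters =
    subst₂ InsertionStep (sym (map-++-context (p +_) L H u f v S)) (bar-context u v (a ∷ f) refl a-letter)
      (insert-top (L ++ H ++ map (p +_) u) (complete-lift c (proj₂ a-letter)) (1+maxL-+ f≢[]))
    where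
    a = suc (maxL f)
    a-letter : Letter B a
    a-letter = All.lookup σ-letters (∈-++⁺ʳ (bar a u) (here refl))
  lift-insertion (ins-right u f v c@(f≢[] , _)) _ σ-letters =
    subst₂ InsertionStep (sym (map-++-context (p +_) L H u f v S))
      (trans (bar-context u v (f ++ [ a ]) (map-++ (p +_) f [ a ]) a-letter)
             (cong (λ t → L ++ map suc H ++ map (p +_) (bar a u ++ t) ++ map suc S) (++-assoc f [ a ] (bar a v))))
      (insert-right (L ++ H ++ map (p +_) u) (complete-lift c (proj₂ a-letter)) (1+maxL-+ f≢[]))
    where
    a = suc (maxL f)
    a-letter : Letter B a
    a-letter = All.lookup σ-letters (∈-++⁺ʳ (bar a u) (∈-++⁺ʳ f (here refl)))
  lift-insertion (ins-left u f v c@(f≢[] , _)) _ σ-letters =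
    subst₂ InsertionStep (sym (map-++-context (p +_) L H u f v S))
      (bar-context u v (a ∷ bar a f) (cong (p + a ∷_) (sym (bar-+ p a f))) a-letter)
      (insert-left (L ++ H ++ map (p +_) u) (complete-lift c f<B) (sym (minL-+ p f≢[])))
    where
    a = minL f
    a-letter : Letter B a
    a-letter = All.lookup σ-letters (∈-++⁺ʳ (bar a u) (here refl))
    -- The letters of f appear in σ as bar a f = 1 + f, so they stay below B.
    f<B : maxL f < B
    f<B = subst (_≤ B) (trans (cong maxL (bar-≥ {w = f} (All.tabulate minL-lower))) (maxL-+ 1 f≢[]))
            (maxL-lub (All.map proj₂ (++⁻ˡ (bar a f) (All.tail (++⁻ʳ (bar a u) σ-letters)))))

insert-max : ∀ {p q I J} → OSS p I → OSS q J →
  InsertionStep (I ++ map (p +_) J) (I ++ suc (p + q) ∷ map (p +_) J)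
insert-max oss-empty oss-empty = ins-empty
insert-max {p} {I = I} oI@(oss-node _ _) oss-empty =
  subst (InsertionStep (I ++ [])) (++-identityʳ _)
    (insert-right [] {v = []} (complete-end (oss-≢[] oI) (oss-compact oI))
      (cong suc (trans (+-identityʳ p) (sym (oss-max oI)))))
insert-max {p} {q} {I} {J} oI oJ@(oss-node _ _) =
  subst₂ InsertionStep (cong (I ++_) (++-identityʳ J′))
                       (cong₂ _++_ (bar-< I<N) (cong (N ∷_) (++-identityʳ J′)))
    (insert-top I {v = []} (complete-end (map-≢[] (oss-≢[] oJ)) (compact-+ p (oss-compact oJ))) N≡)
  where
  N = suc (p + q)
  J′ = map (p +_) J
  I<N : All (_< N) I
  I<N = All.map (λ (_ , x≤p) → s≤s (≤-trans x≤p (m≤m+n p q))) (oss-letters oI)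
  N≡ : N ≡ suc (maxL J′)
  N≡ = cong suc (sym (trans (maxL-+ p (oss-≢[] oJ)) (cong (p +_) (oss-max oJ))))

insert-min : ∀ {n S} → OSS (suc n) S → InsertionStep S (1 ∷ map suc S)
insert-min {S = S} o =
  subst₂ InsertionStep (++-identityʳ S) (cong (1 ∷_) (trans (++-identityʳ _) (bar-≥ 1≤S)))
    (insert-left [] {v = []} (complete-end (oss-≢[] o) (oss-compact o)) (sym min≡1))
  where
  1≤S : All (1 ≤_) S
  1≤S = All.map proj₁ (oss-letters o)
  min≡1 : minL S ≡ 1
  min≡1 = minL-≡ (oss-∈ o (≤-refl , s≤s z≤n)) 1≤S

-- If τ = [] then J = 1, and deleting p + 1 from I (p + 2) (p + 1) gives the same word as deleting p + 2.
insertion-right-of-root : ∀ {p q I J τ} → OSS p I → OSS q J → InsertionStep τ J →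
  InsertionStep (I ++ p + q ∷ map (p +_) τ) (I ++ suc (p + q) ∷ map (p +_) J)
insertion-right-of-root {τ = []} oI oJ step
  with refl ← insertion-into-[] step refl with refl ← oss-max oJ = insert-max oI oJ
insertion-right-of-root {p} {q} {I} {J} {τ@(_ ∷ _)} oI oJ step =
  subst₂ InsertionStep (cong (λ t → I ++ p + q ∷ t) (++-identityʳ _))
                       (cong (λ t → I ++ suc (p + q) ∷ t) (++-identityʳ _))
    (lift-insertion p {L = I} {[ p + q ]} {[]} (All.map proj₂ (oss-letters oI)) (≤-refl ∷ []) []
      step (λ ()) (oss-letters oJ))

insertion-left-of-root : ∀ {p q I J τ} → OSS p I → OSS q J → InsertionStep τ I →
  InsertionStep (τ ++ map pred (suc (p + q) ∷ map (p +_) J)) (I ++ suc (p + q) ∷ map (p +_) J)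
insertion-left-of-root {q = q} {J = J} {τ = []} oI oJ step
  with refl ← insertion-into-[] step refl with refl ← oss-max oI =
  subst₂ InsertionStep (cong (suc q ∷_) (map-∘ J)) (cong (λ t → 1 ∷ suc (suc q) ∷ t) (sym (map-∘ J)))
    (insert-min (oss-node oss-empty oJ))
insertion-left-of-root {p} {q} {I} {J} {τ@(_ ∷ _)} oI oJ step =
  subst₂ InsertionStep (cong (_++ map pred T) (map-id τ)) (cong₂ _++_ (map-id I) (map-suc-pred T>p))
    (lift-insertion 0 {L = []} {[]} {map pred T} [] [] (map⁺ (All.map <⇒≤pred T>p))
      step (λ ()) (oss-letters oI))
  where
  T = suc (p + q) ∷ map (p +_) J
  T>p : All (p <_) T
  T>p = upper-part-> p oJ

map-squash-left-of-root : ∀ {x p} α γ T → x ≤ p → All (p <_) T →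
  map (squash x) (α ++ γ ++ T) ≡ map (squash x) (α ++ γ) ++ map pred T
map-squash-left-of-root {x} α γ T x≤p p<T = begin
  map (squash x) (α ++ γ ++ T)                ≡⟨ cong (map (squash x)) (++-assoc α γ T) ⟨
  map (squash x) ((α ++ γ) ++ T)              ≡⟨ map-++ (squash x) (α ++ γ) T ⟩
  map (squash x) (α ++ γ) ++ map (squash x) T ≡⟨ cong (_ ++_) (map-squash-> x<T) ⟩
  map (squash x) (α ++ γ) ++ map pred T       ∎
  where
  open ≡-Reasoning
  x<T : All (x <_) T
  x<T = All.map (≤-<-trans x≤p) p<T

map-squash-right-of-root : ∀ {p q x} I δ β → All (_≤ p) I → x ≤ q →
  map (squash (p + x)) ((I ++ suc (p + q) ∷ map (p +_) δ) ++ map (p +_) β)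
    ≡ I ++ p + q ∷ map (p +_) (map (squash x) (δ ++ β))
map-squash-right-of-root {p} {q} {x} I δ β I≤p x≤q = begin
  map (squash (p + x)) ((I ++ suc (p + q) ∷ map (p +_) δ) ++ map (p +_) β)
    ≡⟨ cong (map (squash (p + x))) (++-assoc I _ _) ⟩
  map (squash (p + x)) (I ++ suc (p + q) ∷ map (p +_) δ ++ map (p +_) β)
    ≡⟨ map-++ (squash (p + x)) I _ ⟩
  map (squash (p + x)) I ++ squash (p + x) (suc (p + q)) ∷ map (squash (p + x)) (map (p +_) δ ++ map (p +_) β)
    ≡⟨ cong₂ _++_ (map-squash-≤ I≤p+x) (cong₂ _∷_ (squash-> p+x<1+p+q) shifted-part) ⟩
  I ++ p + q ∷ map (p +_) (map (squash x) (δ ++ β)) ∎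
  where
  open ≡-Reasoning
  I≤p+x : All (_≤ p + x) I
  I≤p+x = All.map (λ y≤p → ≤-trans y≤p (m≤m+n p x)) I≤p
  p+x<1+p+q : p + x < suc (p + q)
  p+x<1+p+q = s≤s (+-monoʳ-≤ p x≤q)
  shifted-part : map (squash (p + x)) (map (p +_) δ ++ map (p +_) β) ≡ map (p +_) (map (squash x) (δ ++ β))
  shifted-part = trans (cong (map (squash (p + x))) (sym (map-++ (p +_) δ β))) (map-squash-+ p x (δ ++ β))

oss-deletion⇒insertion : ∀ {n σ α x β} → OSS n σ → σ ≡ α ++ x ∷ β →
  InsertionStep (map (squash x) (α ++ β)) σ
oss-deletion⇒insertion {α = []}    oss-empty ()
oss-deletion⇒insertion {α = _ ∷ _} oss-empty ()
oss-deletion⇒insertion {α = α} {x} (oss-node {p} {q} {I} {J} oI oJ) σ≡ with ++-∷-split I σ≡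
... | inj₁ (γ , refl , refl) =
  subst₂ InsertionStep (sym (map-squash-left-of-root α γ _ x≤p (upper-part-> p oJ))) refl
    (insertion-left-of-root oI oJ (oss-deletion⇒insertion oI refl))
  where
  x≤p : x ≤ p
  x≤p = proj₂ (All.lookup (oss-letters oI) (∈-++⁺ʳ α (here refl)))
... | inj₂ (inj₁ (refl , refl , refl)) =
  subst₂ InsertionStep (sym (map-squash-≤ (All.map proj₂ I++J′-letters))) refl (insert-max oI oJ)
  where
  σ-letters : All (Letter (suc (p + q))) (I ++ suc (p + q) ∷ map (p +_) J)
  σ-letters = oss-letters (oss-node oI oJ)
  I++J′-letters : All (Letter (suc (p + q))) (I ++ map (p +_) J)
  I++J′-letters = ++⁺ (++⁻ˡ I σ-letters) (All.tail (++⁻ʳ I σ-letters))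
... | inj₂ (inj₂ (δ , refl , J′≡))
  with δ₀ , x₀ ∷ β₀ , refl , refl , refl ← map-++⁻ (p +_) J δ J′≡ =
  subst₂ InsertionStep (sym (map-squash-right-of-root I δ₀ β₀ I≤p x₀≤q)) refl
    (insertion-right-of-root oI oJ (oss-deletion⇒insertion oJ refl))
  where
  I≤p : All (_≤ p) I
  I≤p = All.map proj₂ (oss-letters oI)
  x₀≤q : x₀ ≤ q
  x₀≤q = proj₂ (All.lookup (oss-letters oJ) (∈-++⁺ʳ δ₀ (here refl)))

-- The hypothesis on τ is unused: deleting a letter preserves one-stack sortability.
mainTheorem3 : (σ τ : List ℕ) → OneStackSortable σ → OneStackSortable τ →
                   DeletionStep σ τ ⇔ InsertionStep τ σ
mainTheorem3 σ τ (_ , σ-oss) _ = mk⇔ deletion⇒insertion insertion⇒deletion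
  where
  deletion⇒insertion : DeletionStep σ τ → InsertionStep τ σ
  deletion⇒insertion step =
    let _ , _ , _ , σ≡ , τ≡ = deletion⁻ step
    in subst₂ InsertionStep (sym τ≡) refl (oss-deletion⇒insertion σ-oss σ≡)
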